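{- Let $G$ be a finite abelian group and let $f$ be an automorphism of the monoid $\mathcal{P}_{0}(G)$. Then $f$ maps every $2$-element set in $\mathcal{P}_{0}(G)$ to a $2$-element set.
   Context: For an additively written finite abelian group $G$, $\mathcal{P}_{0}(G)$ denotes the reduced power monoid of $G$: the set of all subsets of $G$ containing $0$, with the operation of setwise addition $X+Y=\{x+y : x\in X, y\in Y\}$ and identity $\{0\}$. -}

module Defs where

open import Data.Nat using (ℕ)
open import Data.Fin using (Fin; _≟_)
open import Data.Fin.Properties using (any?)
open import Data.Fin.Subset using (Subset; _∈_; ⁅_⁆)
open import Data.Fin.Subset.Properties using (_∈?_)
open import Data.Vec using (tabulate)
open import Data.Product using (Σ; _×_; _,_)
open import Relation.Nullary.Decidable using (⌊_⌋; _×-dec_)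
open import Relation.Binary.PropositionalEquality using (_≡_)
open import Algebra.Structures using (IsAbelianGroup)

-- A finite abelian group, presented (up to isomorphism) on the carrier Fin order.
record FiniteAbelianGroup : Set where
  field
    order          : ℕ
    _⊕_            : Fin order → Fin order → Fin order
    0#             : Fin order
    ⊖_             : Fin order → Fin order
    isAbelianGroup : IsAbelianGroup _≡_ _⊕_ 0# ⊖_

module _ (G : FiniteAbelianGroup) where
  open FiniteAbelianGroup G

  _+ˢ_ : Subset order → Subset order → Subset order
  X +ˢ Y = tabulate λ z →
    ⌊ any? (λ x → any? (λ y → (x ∈? X) ×-dec ((y ∈? Y) ×-dec ((x ⊕ y) ≟ z)))) ⌋

  InP₀ : Subset order → Set
  InP₀ X = 0# ∈ X

  zeroSet : Subset order
  zeroSet = ⁅ 0# ⁆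

  -- f : Subset G → Subset G restricts to a monoid automorphism of P₀(G).
  record IsP₀Automorphism (f : Subset order → Subset order) : Set where
    field
      closed     : ∀ X → InP₀ X → InP₀ (f X)
      injective  : ∀ X Y → InP₀ X → InP₀ Y → f X ≡ f Y → X ≡ Y
      surjective : ∀ Y → InP₀ Y → Σ (Subset order) λ X → InP₀ X × f X ≡ Y
      hom        : ∀ X Y → InP₀ X → InP₀ Y → f (X +ˢ Y) ≡ f X +ˢ f Y
      unit       : f zeroSet ≡ zeroSet

-- Write k·X for the k-fold sumset ({0} when k = 0) and ⟨X⟩ for the subgroup generated by X ∋ 0,
-- where the chain {0} ⊆ X ⊆ 2·X ⊆ … stabilises. An automorphism f commutes with k·_ and is
-- injective, so the chain of Y = f(X) stalls exactly where that of X does. For X = {0, a} every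
-- strict step adds at most one element while every strict step for Y adds at least one; starting
-- from |X| ≤ 2 this gives |⟨X⟩| + |Y| ≤ |⟨Y⟩| + 2. On the other hand a set Z ∋ 0 lies in a subgroup
-- H iff H + Z = H, so f⁻¹ embeds the sets between {0} and ⟨Y⟩ into those between {0} and ⟨X⟩, and
-- counting them (2^(|H|-1) each) gives |⟨Y⟩| ≤ |⟨X⟩|. Hence |Y| ≤ 2, and |Y| ≥ 2 because f is
-- injective and fixes {0}.

module Submission where

open import Defs
open import Data.Fin.Subset using (Subset; ∣_∣)
open import Relation.Binary.PropositionalEquality using (_≡_)

open import Data.Nat using (ℕ; zero; suc; _+_; _*_; _^_; _≤_; _<_; s≤s)
open import Data.Nat.Properties
  using (≤-refl; ≤-trans; ≤-antisym; ≤-reflexive; <⇒≱; ≮⇒≥; +-suc; +-comm; +-monoˡ-≤; +-cancelˡ-≤;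
         n≤1+n; *-monoʳ-≤; ^-monoʳ-<; *-distribˡ-+; *-assoc; +-identityʳ; module ≤-Reasoning)
open import Data.Fin using (Fin; zero; suc)
open import Data.Fin.Properties using (any?; injective⇒≤)
open import Data.Fin.Subset using (_∈_; _∉_; _⊆_; ⁅_⁆; _∪_; inside; outside)
open import Data.Fin.Subset.Properties
  using (_∈?_; ⊆-antisym; p⊆q⇒∣p∣≤∣q∣; p⊂q⇒∣p∣<∣q∣; x∈⁅x⁆; x∈⁅y⁆⇒x≡y; x≢y⇒x∉⁅y⁆; x∉⁅y⁆⇒x≢y; ∣⁅x⁆∣≡1;
         x∈p∪q⁺; x∈p∪q⁻; q⊆p∪q; drop-∷-⊆; s⊆s; out⊆; ∣p∣≤n)
import Data.Bool as Bool
open import Data.Bool.Properties using (T-≡)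
open import Data.Vec using ([]; _∷_; here)
open import Data.Vec.Properties using (≡-dec; ∷-injectiveʳ; lookup∘tabulate; []=⇒lookup; lookup⇒[]=)
open import Data.List using (List; []; _∷_; [_]; map; _++_; length)
import Data.List as List
open import Data.List.Properties using (length-map; length-++)
import Data.List.Relation.Unary.Any as Any
open import Data.List.Relation.Unary.All using ([]; _∷_)
import Data.List.Relation.Unary.All as All
open import Data.List.Relation.Unary.AllPairs using ([]; _∷_)
open import Data.List.Relation.Unary.Unique.Propositional using (Unique)
import Data.List.Relation.Unary.Unique.Propositional.Properties as Unique
open import Data.List.Membership.Propositional using () renaming (_∈_ to _∈ₗ_)
open import Data.List.Membership.Propositional.Properties using (∈-lookup; ∈-map⁺; ∈-map⁻; ∈-++⁺ˡ; ∈-++⁺ʳ; ∈-++⁻)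
open import Data.List.Membership.Setoid.Properties using (index-injective)
open import Data.Product using (∃-syntax; _×_; _,_; proj₁; proj₂) renaming (map to ×-map)
open import Data.Sum using (_⊎_; inj₁; inj₂)
open import Data.Empty using (⊥)
open import Function using (Equivalence; _∘_)
open import Relation.Nullary using (Dec; yes; no; contradiction)
open import Relation.Nullary.Decidable using (_×-dec_; ¬?; toWitness; fromWitness)
open import Relation.Binary.PropositionalEquality
  using (_≢_; ≢-sym; refl; sym; trans; cong; cong₂; subst; subst₂; setoid; module ≡-Reasoning)
open import Algebra.Structures using (IsAbelianGroup)

private
  variable
    n : ℕ
    p q : Subset n
    x y : Fin n

⊆-or-witness : (p q : Subset n) → p ⊆ q ⊎ ∃[ x ] x ∈ p × x ∉ q
⊆-or-witness p q with any? (λ x → (x ∈? p) ×-dec ¬? (x ∈? q))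
... | yes witness = inj₂ witness
... | no none = inj₁ p⊆q
  where
  p⊆q : p ⊆ q
  p⊆q {x} x∈p with x ∈? q
  ... | yes x∈q = x∈q
  ... | no x∉q = contradiction (x , x∈p , x∉q) none

p⊆q∧p≢q⇒∣p∣<∣q∣ : p ⊆ q → p ≢ q → ∣ p ∣ < ∣ q ∣
p⊆q∧p≢q⇒∣p∣<∣q∣ {p = p} {q} p⊆q p≢q with ⊆-or-witness q p
... | inj₁ q⊆p = contradiction (⊆-antisym p⊆q q⊆p) p≢q
... | inj₂ witness = p⊂q⇒∣p∣<∣q∣ (p⊆q , witness)

p⊆q∧∣q∣≤∣p∣⇒p≡q : p ⊆ q → ∣ q ∣ ≤ ∣ p ∣ → p ≡ q
p⊆q∧∣q∣≤∣p∣⇒p≡q {p = p} {q} p⊆q ∣q∣≤∣p∣ with ⊆-or-witness q p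
... | inj₁ q⊆p = ⊆-antisym p⊆q q⊆p
... | inj₂ witness = contradiction ∣q∣≤∣p∣ (<⇒≱ (p⊂q⇒∣p∣<∣q∣ (p⊆q , witness)))

∣p∪q∣≤∣p∣+∣q∣ : (p q : Subset n) → ∣ p ∪ q ∣ ≤ ∣ p ∣ + ∣ q ∣
∣p∪q∣≤∣p∣+∣q∣ []              []              = ≤-refl
∣p∪q∣≤∣p∣+∣q∣ (inside ∷ p)  (inside ∷ q)  =
  s≤s (≤-trans (≤-trans (∣p∪q∣≤∣p∣+∣q∣ p q) (n≤1+n _)) (≤-reflexive (sym (+-suc ∣ p ∣ ∣ q ∣))))
∣p∪q∣≤∣p∣+∣q∣ (inside ∷ p)  (outside ∷ q) = s≤s (∣p∪q∣≤∣p∣+∣q∣ p q)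
∣p∪q∣≤∣p∣+∣q∣ (outside ∷ p) (inside ∷ q)  =
  ≤-trans (s≤s (∣p∪q∣≤∣p∣+∣q∣ p q)) (≤-reflexive (sym (+-suc ∣ p ∣ ∣ q ∣)))
∣p∪q∣≤∣p∣+∣q∣ (outside ∷ p) (outside ∷ q) = ∣p∪q∣≤∣p∣+∣q∣ p q

x∈p⇒⁅x⁆⊆p : x ∈ p → ⁅ x ⁆ ⊆ p
x∈p⇒⁅x⁆⊆p {x = x} x∈p y∈⁅x⁆ = subst (_∈ _) (sym (x∈⁅y⁆⇒x≡y x y∈⁅x⁆)) x∈p

x∈p∧p≢⁅x⁆⇒2≤∣p∣ : x ∈ p → p ≢ ⁅ x ⁆ → 2 ≤ ∣ p ∣
x∈p∧p≢⁅x⁆⇒2≤∣p∣ {x = x} x∈p p≢⁅x⁆ =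
  subst (_< _) (∣⁅x⁆∣≡1 x) (p⊆q∧p≢q⇒∣p∣<∣q∣ (x∈p⇒⁅x⁆⊆p x∈p) (λ eq → p≢⁅x⁆ (sym eq)))

∈⁅x⁆∪⁅y⁆⁻ : ∀ {z} → z ∈ ⁅ x ⁆ ∪ ⁅ y ⁆ → z ≡ x ⊎ z ≡ y
∈⁅x⁆∪⁅y⁆⁻ {x = x} {y} z∈ with x∈p∪q⁻ ⁅ x ⁆ ⁅ y ⁆ z∈
... | inj₁ z∈⁅x⁆ = inj₁ (x∈⁅y⁆⇒x≡y x z∈⁅x⁆)
... | inj₂ z∈⁅y⁆ = inj₂ (x∈⁅y⁆⇒x≡y y z∈⁅y⁆)

∣p∣≡2⇒p≢⁅x⁆ : ∣ p ∣ ≡ 2 → p ≢ ⁅ x ⁆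
∣p∣≡2⇒p≢⁅x⁆ {x = x} ∣p∣≡2 refl = contradiction (trans (sym ∣p∣≡2) (∣⁅x⁆∣≡1 x)) λ ()

∣⁅x⁆∪⁅y⁆∣≤2 : (x y : Fin n) → ∣ ⁅ x ⁆ ∪ ⁅ y ⁆ ∣ ≤ 2
∣⁅x⁆∪⁅y⁆∣≤2 x y = ≤-trans (∣p∪q∣≤∣p∣+∣q∣ ⁅ x ⁆ ⁅ y ⁆) (≤-reflexive (cong₂ _+_ (∣⁅x⁆∣≡1 x) (∣⁅x⁆∣≡1 y)))

x≢y⇒2≤∣⁅x⁆∪⁅y⁆∣ : x ≢ y → 2 ≤ ∣ ⁅ x ⁆ ∪ ⁅ y ⁆ ∣
x≢y⇒2≤∣⁅x⁆∪⁅y⁆∣ {x = x} {y} x≢y = subst (_< ∣ ⁅ x ⁆ ∪ ⁅ y ⁆ ∣) (∣⁅x⁆∣≡1 y)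
  (p⊂q⇒∣p∣<∣q∣ (q⊆p∪q ⁅ x ⁆ ⁅ y ⁆ , x , x∈p∪q⁺ (inj₁ (x∈⁅x⁆ x)) , x≢y⇒x∉⁅y⁆ x≢y))

x∈p∧∣p∣≡2⇒p≡⁅x⁆∪⁅y⁆ : x ∈ p → ∣ p ∣ ≡ 2 → ∃[ y ] p ≡ ⁅ x ⁆ ∪ ⁅ y ⁆
x∈p∧∣p∣≡2⇒p≡⁅x⁆∪⁅y⁆ {x = x} {p} x∈p ∣p∣≡2 with ⊆-or-witness p ⁅ x ⁆
... | inj₁ p⊆⁅x⁆ with subst₂ _≤_ ∣p∣≡2 (∣⁅x⁆∣≡1 x) (p⊆q⇒∣p∣≤∣q∣ p⊆⁅x⁆)
...   | s≤s ()
x∈p∧∣p∣≡2⇒p≡⁅x⁆∪⁅y⁆ {x = x} {p} x∈p ∣p∣≡2 | inj₂ (y , y∈p , y∉⁅x⁆) =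
  y , sym (p⊆q∧∣q∣≤∣p∣⇒p≡q ⁅x⁆∪⁅y⁆⊆p
           (subst (_≤ _) (sym ∣p∣≡2) (x≢y⇒2≤∣⁅x⁆∪⁅y⁆∣ (≢-sym (x∉⁅y⁆⇒x≢y y∉⁅x⁆)))))
  where
  ⁅x⁆∪⁅y⁆⊆p : ⁅ x ⁆ ∪ ⁅ y ⁆ ⊆ p
  ⁅x⁆∪⁅y⁆⊆p z∈ with ∈⁅x⁆∪⁅y⁆⁻ z∈
  ... | inj₁ refl = x∈p
  ... | inj₂ refl = y∈p

_∈[_,_] : Subset n → Subset n → Subset n → Set
S ∈[ lo , hi ] = lo ⊆ S × S ⊆ hi

drop-∷-∈[,] : ∀ {a b c} {S lo hi : Subset n} → (a ∷ S) ∈[ b ∷ lo , c ∷ hi ] → S ∈[ lo , hi ]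
drop-∷-∈[,] (lo⊆S , S⊆hi) = drop-∷-⊆ lo⊆S , drop-∷-⊆ S⊆hi

interval : Subset n → Subset n → List (Subset n)
interval []             []             = [ [] ]
interval (inside ∷ lo)  (inside ∷ hi)  = map (inside ∷_) (interval lo hi)
interval (inside ∷ lo)  (outside ∷ hi) = []
interval (outside ∷ lo) (outside ∷ hi) = map (outside ∷_) (interval lo hi)
interval (outside ∷ lo) (inside ∷ hi)  = map (outside ∷_) (interval lo hi) ++ map (inside ∷_) (interval lo hi)

interval-unique : (lo hi : Subset n) → Unique (interval lo hi)
interval-unique []             []             = [] ∷ []
interval-unique (inside ∷ lo)  (inside ∷ hi)  = Unique.map⁺ ∷-injectiveʳ (interval-unique lo hi)
interval-unique (inside ∷ lo)  (outside ∷ hi) = []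
interval-unique (outside ∷ lo) (outside ∷ hi) = Unique.map⁺ ∷-injectiveʳ (interval-unique lo hi)
interval-unique (outside ∷ lo) (inside ∷ hi)  =
  Unique.++⁺ (Unique.map⁺ ∷-injectiveʳ (interval-unique lo hi)) (Unique.map⁺ ∷-injectiveʳ (interval-unique lo hi)) disjoint
  where
  disjoint : ∀ {S} → S ∈ₗ map (outside ∷_) (interval lo hi) × S ∈ₗ map (inside ∷_) (interval lo hi) → ⊥
  disjoint (S∈ₗouts , S∈ₗins) with ∈-map⁻ (outside ∷_) S∈ₗouts | ∈-map⁻ (inside ∷_) S∈ₗins
  ... | _ , _ , refl | _ , _ , ()

∈-interval⁻ : (lo hi : Subset n) {S : Subset n} → S ∈ₗ interval lo hi → S ∈[ lo , hi ]
∈-interval⁻ []             []             (Any.here refl) = (λ ()) , (λ ())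
∈-interval⁻ (inside ∷ lo)  (inside ∷ hi)  S∈ with ∈-map⁻ (inside ∷_) S∈
... | T , T∈ , refl = ×-map s⊆s s⊆s (∈-interval⁻ lo hi T∈)
∈-interval⁻ (outside ∷ lo) (outside ∷ hi) S∈ with ∈-map⁻ (outside ∷_) S∈
... | T , T∈ , refl = ×-map s⊆s s⊆s (∈-interval⁻ lo hi T∈)
∈-interval⁻ (outside ∷ lo) (inside ∷ hi)  S∈ with ∈-++⁻ (map (outside ∷_) (interval lo hi)) S∈
... | inj₁ S∈outs with ∈-map⁻ (outside ∷_) S∈outs
...   | T , T∈ , refl = ×-map s⊆s out⊆ (∈-interval⁻ lo hi T∈)
∈-interval⁻ (outside ∷ lo) (inside ∷ hi)  S∈ | inj₂ S∈ins with ∈-map⁻ (inside ∷_) S∈ins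
...   | T , T∈ , refl = ×-map out⊆ s⊆s (∈-interval⁻ lo hi T∈)

∈-interval⁺ : (lo hi : Subset n) {S : Subset n} → S ∈[ lo , hi ] → S ∈ₗ interval lo hi
∈-interval⁺ []             []             {[]}          _             = Any.here refl
∈-interval⁺ (inside ∷ lo)  _              {outside ∷ S} (lo⊆S , _)    = contradiction (lo⊆S here) λ ()
∈-interval⁺ _              (outside ∷ hi) {inside ∷ S}  (_ , S⊆hi)    = contradiction (S⊆hi here) λ ()
∈-interval⁺ (inside ∷ lo)  (inside ∷ hi)  {inside ∷ S}  S∈[lo,hi] =
  ∈-map⁺ (inside ∷_) (∈-interval⁺ lo hi (drop-∷-∈[,] S∈[lo,hi]))
∈-interval⁺ (outside ∷ lo) (outside ∷ hi) {outside ∷ S} S∈[lo,hi] =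
  ∈-map⁺ (outside ∷_) (∈-interval⁺ lo hi (drop-∷-∈[,] S∈[lo,hi]))
∈-interval⁺ (outside ∷ lo) (inside ∷ hi)  {outside ∷ S} S∈[lo,hi] =
  ∈-++⁺ˡ (∈-map⁺ (outside ∷_) (∈-interval⁺ lo hi (drop-∷-∈[,] S∈[lo,hi])))
∈-interval⁺ (outside ∷ lo) (inside ∷ hi)  {inside ∷ S}  S∈[lo,hi] =
  ∈-++⁺ʳ _ (∈-map⁺ (inside ∷_) (∈-interval⁺ lo hi (drop-∷-∈[,] S∈[lo,hi])))

length-interval : (lo hi : Subset n) → lo ⊆ hi → 2 ^ ∣ lo ∣ * length (interval lo hi) ≡ 2 ^ ∣ hi ∣
length-interval []             []             _     = refl
length-interval (inside ∷ lo)  (outside ∷ hi) lo⊆hi = contradiction (lo⊆hi here) λ ()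
length-interval (inside ∷ lo)  (inside ∷ hi)  lo⊆hi = begin
  2 * 2 ^ ∣ lo ∣ * length (map (inside ∷_) (interval lo hi)) ≡⟨ cong (2 * 2 ^ ∣ lo ∣ *_) (length-map _ (interval lo hi)) ⟩
  2 * 2 ^ ∣ lo ∣ * length (interval lo hi)                    ≡⟨ *-assoc 2 (2 ^ ∣ lo ∣) _ ⟩
  2 * (2 ^ ∣ lo ∣ * length (interval lo hi))                  ≡⟨ cong (2 *_) (length-interval lo hi (drop-∷-⊆ lo⊆hi)) ⟩
  2 * 2 ^ ∣ hi ∣                                              ∎
  where open ≡-Reasoning
length-interval (outside ∷ lo) (outside ∷ hi) lo⊆hi = begin
  2 ^ ∣ lo ∣ * length (map (outside ∷_) (interval lo hi)) ≡⟨ cong (2 ^ ∣ lo ∣ *_) (length-map _ (interval lo hi)) ⟩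
  2 ^ ∣ lo ∣ * length (interval lo hi)                    ≡⟨ length-interval lo hi (drop-∷-⊆ lo⊆hi) ⟩
  2 ^ ∣ hi ∣                                              ∎
  where open ≡-Reasoning
length-interval (outside ∷ lo) (inside ∷ hi)  lo⊆hi = begin
  2 ^ ∣ lo ∣ * length (map (outside ∷_) I ++ map (inside ∷_) I)
    ≡⟨ cong (2 ^ ∣ lo ∣ *_) (length-++ (map (outside ∷_) I)) ⟩
  2 ^ ∣ lo ∣ * (length (map (outside ∷_) I) + length (map (inside ∷_) I))
    ≡⟨ cong (2 ^ ∣ lo ∣ *_) (cong₂ _+_ (length-map _ I) (length-map _ I)) ⟩
  2 ^ ∣ lo ∣ * (length I + length I)
    ≡⟨ *-distribˡ-+ (2 ^ ∣ lo ∣) (length I) (length I) ⟩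
  2 ^ ∣ lo ∣ * length I + 2 ^ ∣ lo ∣ * length I
    ≡⟨ cong (λ m → m + m) (length-interval lo hi (drop-∷-⊆ lo⊆hi)) ⟩
  2 ^ ∣ hi ∣ + 2 ^ ∣ hi ∣
    ≡⟨ cong (2 ^ ∣ hi ∣ +_) (sym (+-identityʳ (2 ^ ∣ hi ∣))) ⟩
  2 * 2 ^ ∣ hi ∣
    ∎
  where
  I = interval lo hi
  open ≡-Reasoning

lookup-injective : {A : Set} {xs : List A} → Unique xs → ∀ i j → List.lookup xs i ≡ List.lookup xs j → i ≡ j
lookup-injective {xs = _ ∷ _}  _              zero    zero    _  = refl
lookup-injective {xs = _ ∷ _}  (x∉xs ∷ _)    zero    (suc j) eq = contradiction eq (All.lookup x∉xs (∈-lookup j))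
lookup-injective {xs = _ ∷ _}  (x∉xs ∷ _)    (suc i) zero    eq = contradiction (sym eq) (All.lookup x∉xs (∈-lookup i))
lookup-injective {xs = _ ∷ _}  (_ ∷ uniq)    (suc i) (suc j) eq = cong suc (lookup-injective uniq i j eq)

injectiveOn⇒length≤ : {A B : Set} {xs : List A} {ys : List B} → Unique xs → (g : A → B) →
  (∀ {x} → x ∈ₗ xs → g x ∈ₗ ys) → (∀ {x y} → x ∈ₗ xs → y ∈ₗ xs → g x ≡ g y → x ≡ y) →
  length xs ≤ length ys
injectiveOn⇒length≤ {xs = xs} {ys} uniq g g∈ g-injective = injective⇒≤ index∘g-injective
  where
  index∘g : Fin (length xs) → Fin (length ys)
  index∘g i = Any.index (g∈ (∈-lookup i))
  index∘g-injective : ∀ {i j} → index∘g i ≡ index∘g j → i ≡ j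
  index∘g-injective {i} {j} eq = lookup-injective uniq i j
    (g-injective (∈-lookup i) (∈-lookup j) (index-injective (setoid _) (g∈ (∈-lookup i)) (g∈ (∈-lookup j)) eq))

2^m≤2^n⇒m≤n : ∀ {m n} → 2 ^ m ≤ 2 ^ n → m ≤ n
2^m≤2^n⇒m≤n 2^m≤2^n = ≮⇒≥ λ n<m → <⇒≱ (^-monoʳ-< 2 ≤-refl n<m) 2^m≤2^n

interval-injection⇒∣∣≤ : {lo hi hi′ : Subset n} (h : Subset n → Subset n) → lo ⊆ hi → lo ⊆ hi′ →
  (∀ {S} → S ∈[ lo , hi ] → h S ∈[ lo , hi′ ]) →
  (∀ {S T} → S ∈[ lo , hi ] → T ∈[ lo , hi ] → h S ≡ h T → S ≡ T) →
  ∣ hi ∣ ≤ ∣ hi′ ∣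
interval-injection⇒∣∣≤ {lo = lo} {hi} {hi′} h lo⊆hi lo⊆hi′ h-maps h-injective = 2^m≤2^n⇒m≤n (begin
  2 ^ ∣ hi ∣                             ≡⟨ sym (length-interval lo hi lo⊆hi) ⟩
  2 ^ ∣ lo ∣ * length (interval lo hi)  ≤⟨ *-monoʳ-≤ (2 ^ ∣ lo ∣) length≤ ⟩
  2 ^ ∣ lo ∣ * length (interval lo hi′) ≡⟨ length-interval lo hi′ lo⊆hi′ ⟩
  2 ^ ∣ hi′ ∣                            ∎)
  where
  open ≤-Reasoning
  length≤ : length (interval lo hi) ≤ length (interval lo hi′)
  length≤ = injectiveOn⇒length≤ (interval-unique lo hi) h
    (λ S∈ → ∈-interval⁺ lo hi′ (h-maps (∈-interval⁻ lo hi S∈)))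
    (λ S∈ T∈ → h-injective (∈-interval⁻ lo hi S∈) (∈-interval⁻ lo hi T∈))

module _ (G : FiniteAbelianGroup) where
  open FiniteAbelianGroup G
  open IsAbelianGroup isAbelianGroup using (assoc; identityˡ; identityʳ)

  private
    variable
      X Y Z C : Subset order

  infixl 6 _⊞_
  _⊞_ : Subset order → Subset order → Subset order
  _⊞_ = _+ˢ_ G

  ∈-⊞⁻ : ∀ {z} → z ∈ X ⊞ Y → ∃[ x ] ∃[ y ] x ∈ X × y ∈ Y × x ⊕ y ≡ z
  ∈-⊞⁻ {z = z} z∈ = toWitness (Equivalence.from T-≡ (trans (sym (lookup∘tabulate _ z)) ([]=⇒lookup z∈)))

  ∈-⊞⁺ : ∀ {x y} → x ∈ X → y ∈ Y → x ⊕ y ∈ X ⊞ Y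
  ∈-⊞⁺ {x = x} {y} x∈X y∈Y =
    lookup⇒[]= (x ⊕ y) _ (trans (lookup∘tabulate _ (x ⊕ y)) (Equivalence.to T-≡ (fromWitness (x , y , x∈X , y∈Y , refl))))

  0∈⊞ : 0# ∈ X → 0# ∈ Y → 0# ∈ X ⊞ Y
  0∈⊞ 0∈X 0∈Y = subst (_∈ _) (identityʳ 0#) (∈-⊞⁺ 0∈X 0∈Y)

  X⊆X⊞Y : 0# ∈ Y → X ⊆ X ⊞ Y
  X⊆X⊞Y 0∈Y {x} x∈X = subst (_∈ _) (identityʳ x) (∈-⊞⁺ x∈X 0∈Y)

  Y⊆X⊞Y : 0# ∈ X → Y ⊆ X ⊞ Y
  Y⊆X⊞Y 0∈X {y} y∈Y = subst (_∈ _) (identityˡ y) (∈-⊞⁺ 0∈X y∈Y)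

  ⁅0⁆-identityˡ : ⁅ 0# ⁆ ⊞ X ≡ X
  ⁅0⁆-identityˡ {X} = ⊆-antisym ⁅0⁆⊞X⊆X (Y⊆X⊞Y (x∈⁅x⁆ 0#))
    where
    ⁅0⁆⊞X⊆X : ⁅ 0# ⁆ ⊞ X ⊆ X
    ⁅0⁆⊞X⊆X z∈ with ∈-⊞⁻ z∈
    ... | u , x , u∈⁅0⁆ , x∈X , refl rewrite x∈⁅y⁆⇒x≡y 0# u∈⁅0⁆ = subst (_∈ X) (sym (identityˡ x)) x∈X

  infixr 7 _·ˢ_ _·_
  _·ˢ_ : ℕ → Subset order → Subset order
  zero  ·ˢ X = ⁅ 0# ⁆
  suc k ·ˢ X = k ·ˢ X ⊞ X

  _·_ : ℕ → Fin order → Fin order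
  zero  · a = 0#
  suc k · a = (k · a) ⊕ a

  0∈⁅0⁆∪⁅a⁆ : ∀ a → 0# ∈ ⁅ 0# ⁆ ∪ ⁅ a ⁆
  0∈⁅0⁆∪⁅a⁆ a = x∈p∪q⁺ (inj₁ (x∈⁅x⁆ 0#))

  0∈·ˢ : 0# ∈ X → ∀ k → 0# ∈ k ·ˢ X
  0∈·ˢ 0∈X zero    = x∈⁅x⁆ 0#
  0∈·ˢ 0∈X (suc k) = 0∈⊞ (0∈·ˢ 0∈X k) 0∈X

  infix 4 _≟ˢ_
  _≟ˢ_ : (X Y : Subset order) → Dec (X ≡ Y)
  _≟ˢ_ = ≡-dec Bool._≟_

  ·ˢ-stalls-or-grows : 0# ∈ X → ∀ k → k ·ˢ X ≡ suc k ·ˢ X ⊎ suc k ≤ ∣ k ·ˢ X ∣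
  ·ˢ-stalls-or-grows 0∈X zero = inj₂ (≤-reflexive (sym (∣⁅x⁆∣≡1 0#)))
  ·ˢ-stalls-or-grows {X} 0∈X (suc k) with ·ˢ-stalls-or-grows 0∈X k | k ·ˢ X ≟ˢ suc k ·ˢ X
  ... | inj₁ stall | _          = inj₁ (cong (_⊞ X) stall)
  ... | inj₂ _     | yes stall  = inj₁ (cong (_⊞ X) stall)
  ... | inj₂ large | no growth  = inj₂ (≤-trans (s≤s large) (p⊆q∧p≢q⇒∣p∣<∣q∣ (X⊆X⊞Y 0∈X) growth))

  -- By ⟨⟩-stable the chain k ·ˢ X has become constant at k = order = |G|, so this is the subgroup generated by X.
  ⟨_⟩ : Subset order → Subset order
  ⟨ X ⟩ = order ·ˢ X

  ⟨⟩-stable : 0# ∈ X → ⟨ X ⟩ ⊞ X ≡ ⟨ X ⟩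
  ⟨⟩-stable {X} 0∈X with ·ˢ-stalls-or-grows 0∈X order
  ... | inj₁ stall = sym stall
  ... | inj₂ large = contradiction (∣p∣≤n ⟨ X ⟩) (<⇒≱ large)

  ⊞-stable⇒closed : C ⊞ X ≡ C → ∀ k {c y} → c ∈ C → y ∈ k ·ˢ X → c ⊕ y ∈ C
  ⊞-stable⇒closed _      zero    {c} c∈C y∈⁅0⁆ rewrite x∈⁅y⁆⇒x≡y 0# y∈⁅0⁆ | identityʳ c = c∈C
  ⊞-stable⇒closed {C} stable (suc k) {c} c∈C y∈ with ∈-⊞⁻ y∈
  ... | u , x , u∈ , x∈X , refl =
    subst (_∈ C) (assoc c u x) (subst (_ ∈_) stable (∈-⊞⁺ (⊞-stable⇒closed stable k c∈C u∈) x∈X))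

  ⟨⟩-absorbs : 0# ∈ X → 0# ∈ Z → Z ⊆ ⟨ X ⟩ → ⟨ X ⟩ ⊞ Z ≡ ⟨ X ⟩
  ⟨⟩-absorbs {X} {Z} 0∈X 0∈Z Z⊆⟨X⟩ = ⊆-antisym ⟨X⟩⊞Z⊆⟨X⟩ (X⊆X⊞Y 0∈Z)
    where
    ⟨X⟩⊞Z⊆⟨X⟩ : ⟨ X ⟩ ⊞ Z ⊆ ⟨ X ⟩
    ⟨X⟩⊞Z⊆⟨X⟩ z∈ with ∈-⊞⁻ z∈
    ... | c , z , c∈ , z∈Z , refl = ⊞-stable⇒closed (⟨⟩-stable 0∈X) order c∈ (Z⊆⟨X⟩ z∈Z)

  ∈-suc·ˢ-pair⁻ : ∀ {a} k {z} → z ∈ suc k ·ˢ (⁅ 0# ⁆ ∪ ⁅ a ⁆) → z ∈ k ·ˢ (⁅ 0# ⁆ ∪ ⁅ a ⁆) ⊎ z ≡ suc k · a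
  ∈-suc·ˢ-pair⁻ k z∈ with ∈-⊞⁻ z∈
  ... | u , x , u∈ , x∈ , refl with ∈⁅x⁆∪⁅y⁆⁻ x∈
  ... | inj₁ refl = inj₁ (subst (_∈ _) (sym (identityʳ u)) u∈)
  ∈-suc·ˢ-pair⁻ zero    _ | u , _ , u∈⁅0⁆ , _ , refl | inj₂ refl = inj₂ (cong (_⊕ _) (x∈⁅y⁆⇒x≡y 0# u∈⁅0⁆))
  ∈-suc·ˢ-pair⁻ (suc k) _ | u , _ , u∈ , _ , refl    | inj₂ refl with ∈-suc·ˢ-pair⁻ k u∈
  ... | inj₁ u∈′ = inj₁ (∈-⊞⁺ u∈′ (x∈p∪q⁺ (inj₂ (x∈⁅x⁆ _))))
  ... | inj₂ refl = inj₂ refl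

  ∣suc·ˢ-pair∣≤ : ∀ a k → ∣ suc k ·ˢ (⁅ 0# ⁆ ∪ ⁅ a ⁆) ∣ ≤ suc ∣ k ·ˢ (⁅ 0# ⁆ ∪ ⁅ a ⁆) ∣
  ∣suc·ˢ-pair∣≤ a k = begin
    ∣ suc k ·ˢ P ∣             ≤⟨ p⊆q⇒∣p∣≤∣q∣ suc·ˢP⊆ ⟩
    ∣ k ·ˢ P ∪ ⁅ suc k · a ⁆ ∣ ≤⟨ ∣p∪q∣≤∣p∣+∣q∣ (k ·ˢ P) ⁅ suc k · a ⁆ ⟩
    ∣ k ·ˢ P ∣ + ∣ ⁅ suc k · a ⁆ ∣ ≡⟨ cong (∣ k ·ˢ P ∣ +_) (∣⁅x⁆∣≡1 (suc k · a)) ⟩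
    ∣ k ·ˢ P ∣ + 1             ≡⟨ +-comm ∣ k ·ˢ P ∣ 1 ⟩
    suc ∣ k ·ˢ P ∣             ∎
    where
    open ≤-Reasoning
    P = ⁅ 0# ⁆ ∪ ⁅ a ⁆
    suc·ˢP⊆ : suc k ·ˢ P ⊆ k ·ˢ P ∪ ⁅ suc k · a ⁆
    suc·ˢP⊆ z∈ with ∈-suc·ˢ-pair⁻ k z∈
    ... | inj₁ z∈k·ˢP = x∈p∪q⁺ (inj₁ z∈k·ˢP)
    ... | inj₂ refl   = x∈p∪q⁺ (inj₂ (x∈⁅x⁆ (suc k · a)))

  module _ {f : Subset order → Subset order} (iso : IsP₀Automorphism G f) where
    open IsP₀Automorphism iso

    f-·ˢ : 0# ∈ X → ∀ k → f (k ·ˢ X) ≡ k ·ˢ f X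
    f-·ˢ 0∈X zero        = unit
    f-·ˢ {X} 0∈X (suc k) = trans (hom (k ·ˢ X) X (0∈·ˢ 0∈X k) 0∈X) (cong (_⊞ f X) (f-·ˢ 0∈X k))

    ·ˢ-stall-preserved : 0# ∈ X → ∀ k → k ·ˢ X ≡ suc k ·ˢ X → k ·ˢ f X ≡ suc k ·ˢ f X
    ·ˢ-stall-preserved 0∈X k stall = trans (sym (f-·ˢ 0∈X k)) (trans (cong f stall) (f-·ˢ 0∈X (suc k)))

    ·ˢ-stall-reflected : 0# ∈ X → ∀ k → k ·ˢ f X ≡ suc k ·ˢ f X → k ·ˢ X ≡ suc k ·ˢ X
    ·ˢ-stall-reflected 0∈X k stall = injective _ _ (0∈·ˢ 0∈X k) (0∈·ˢ 0∈X (suc k))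
      (trans (f-·ˢ 0∈X k) (trans stall (sym (f-·ˢ 0∈X (suc k)))))

    -- A right inverse of f on P₀(G); its value on sets without 0 is junk.
    f⁻¹ : Subset order → Subset order
    f⁻¹ Z with 0# ∈? Z
    ... | yes 0∈Z = proj₁ (surjective Z 0∈Z)
    ... | no  _   = Z

    f⁻¹-inverse : 0# ∈ Z → 0# ∈ f⁻¹ Z × f (f⁻¹ Z) ≡ Z
    f⁻¹-inverse {Z} 0∈Z with 0# ∈? Z
    ... | yes 0∈Z′ = proj₂ (surjective Z 0∈Z′)
    ... | no  0∉Z  = contradiction 0∈Z 0∉Z

    ∣⟨fX⟩∣≤∣⟨X⟩∣ : 0# ∈ X → ∣ ⟨ f X ⟩ ∣ ≤ ∣ ⟨ X ⟩ ∣
    ∣⟨fX⟩∣≤∣⟨X⟩∣ {X} 0∈X =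
      interval-injection⇒∣∣≤ f⁻¹ (x∈p⇒⁅x⁆⊆p 0∈⟨fX⟩) (x∈p⇒⁅x⁆⊆p 0∈⟨X⟩) f⁻¹-maps f⁻¹-injective
      where
      0∈fX  = closed X 0∈X
      0∈⟨X⟩  = 0∈·ˢ 0∈X order
      0∈⟨fX⟩ = 0∈·ˢ 0∈fX order
      f⟨X⟩≡⟨fX⟩ = f-·ˢ 0∈X order

      f⁻¹-maps : Z ∈[ ⁅ 0# ⁆ , ⟨ f X ⟩ ] → f⁻¹ Z ∈[ ⁅ 0# ⁆ , ⟨ X ⟩ ]
      f⁻¹-maps {Z} (⁅0⁆⊆Z , Z⊆⟨fX⟩) = x∈p⇒⁅x⁆⊆p 0∈W , subst (W ⊆_) ⟨X⟩⊞W≡⟨X⟩ (Y⊆X⊞Y 0∈⟨X⟩)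
        where
        open ≡-Reasoning
        0∈Z = ⁅0⁆⊆Z (x∈⁅x⁆ 0#)
        W = f⁻¹ Z
        0∈W = proj₁ (f⁻¹-inverse 0∈Z)
        ⟨X⟩⊞W≡⟨X⟩ : ⟨ X ⟩ ⊞ W ≡ ⟨ X ⟩
        ⟨X⟩⊞W≡⟨X⟩ = injective _ _ (0∈⊞ 0∈⟨X⟩ 0∈W) 0∈⟨X⟩ (begin
          f (⟨ X ⟩ ⊞ W) ≡⟨ hom ⟨ X ⟩ W 0∈⟨X⟩ 0∈W ⟩
          f ⟨ X ⟩ ⊞ f W ≡⟨ cong₂ _⊞_ f⟨X⟩≡⟨fX⟩ (proj₂ (f⁻¹-inverse 0∈Z)) ⟩
          ⟨ f X ⟩ ⊞ Z   ≡⟨ ⟨⟩-absorbs 0∈fX 0∈Z Z⊆⟨fX⟩ ⟩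
          ⟨ f X ⟩       ≡⟨ sym f⟨X⟩≡⟨fX⟩ ⟩
          f ⟨ X ⟩       ∎)

      f⁻¹-injective : ∀ {Z Z′} → Z ∈[ ⁅ 0# ⁆ , ⟨ f X ⟩ ] → Z′ ∈[ ⁅ 0# ⁆ , ⟨ f X ⟩ ] →
                      f⁻¹ Z ≡ f⁻¹ Z′ → Z ≡ Z′
      f⁻¹-injective (⁅0⁆⊆Z , _) (⁅0⁆⊆Z′ , _) eq =
        trans (sym (proj₂ (f⁻¹-inverse (⁅0⁆⊆Z (x∈⁅x⁆ 0#)))))
          (trans (cong f eq) (proj₂ (f⁻¹-inverse (⁅0⁆⊆Z′ (x∈⁅x⁆ 0#)))))

    2≤∣fX∣ : 0# ∈ X → X ≢ ⁅ 0# ⁆ → 2 ≤ ∣ f X ∣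
    2≤∣fX∣ {X} 0∈X X≢⁅0⁆ = x∈p∧p≢⁅x⁆⇒2≤∣p∣ (closed X 0∈X)
      λ fX≡⁅0⁆ → X≢⁅0⁆ (injective _ _ 0∈X (x∈⁅x⁆ 0#) (trans fX≡⁅0⁆ (sym unit)))

    module _ (a : Fin order) where
      private
        P = ⁅ 0# ⁆ ∪ ⁅ a ⁆
        0∈P = 0∈⁅0⁆∪⁅a⁆ a
        0∈fP = closed P 0∈P

      ∣suc·ˢP∣+∣fP∣≤∣suc·ˢfP∣+2 : ∀ k → ∣ suc k ·ˢ P ∣ + ∣ f P ∣ ≤ ∣ suc k ·ˢ f P ∣ + 2
      ∣suc·ˢP∣+∣fP∣≤∣suc·ˢfP∣+2 zero = begin
        ∣ ⁅ 0# ⁆ ⊞ P ∣ + ∣ f P ∣ ≡⟨ cong (λ S → ∣ S ∣ + ∣ f P ∣) ⁅0⁆-identityˡ ⟩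
        ∣ P ∣ + ∣ f P ∣          ≤⟨ +-monoˡ-≤ ∣ f P ∣ (∣⁅x⁆∪⁅y⁆∣≤2 0# a) ⟩
        2 + ∣ f P ∣              ≡⟨ +-comm 2 ∣ f P ∣ ⟩
        ∣ f P ∣ + 2              ≡⟨ cong (λ S → ∣ S ∣ + 2) (sym ⁅0⁆-identityˡ) ⟩
        ∣ ⁅ 0# ⁆ ⊞ f P ∣ + 2     ∎
        where open ≤-Reasoning
      ∣suc·ˢP∣+∣fP∣≤∣suc·ˢfP∣+2 (suc k) with suc k ·ˢ P ≟ˢ suc (suc k) ·ˢ P
      ... | yes stall = subst₂ (λ S T → ∣ S ∣ + ∣ f P ∣ ≤ ∣ T ∣ + 2)
                          stall (·ˢ-stall-preserved 0∈P (suc k) stall) (∣suc·ˢP∣+∣fP∣≤∣suc·ˢfP∣+2 k)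
      ... | no  grows = begin
        ∣ suc (suc k) ·ˢ P ∣ + ∣ f P ∣ ≤⟨ +-monoˡ-≤ ∣ f P ∣ (∣suc·ˢ-pair∣≤ a (suc k)) ⟩
        suc (∣ suc k ·ˢ P ∣ + ∣ f P ∣) ≤⟨ s≤s (∣suc·ˢP∣+∣fP∣≤∣suc·ˢfP∣+2 k) ⟩
        suc (∣ suc k ·ˢ f P ∣ + 2)     ≤⟨ +-monoˡ-≤ 2 (p⊆q∧p≢q⇒∣p∣<∣q∣ (X⊆X⊞Y 0∈fP) fP-grows) ⟩
        ∣ suc (suc k) ·ˢ f P ∣ + 2     ∎
        where
        open ≤-Reasoning
        fP-grows = grows ∘ ·ˢ-stall-reflected 0∈P (suc k)

      ∣f⁅0⁆∪⁅a⁆∣≤2 : ∣ f (⁅ 0# ⁆ ∪ ⁅ a ⁆) ∣ ≤ 2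
      ∣f⁅0⁆∪⁅a⁆∣≤2 = +-cancelˡ-≤ ∣ ⟨ P ⟩ ∣ ∣ f P ∣ 2 (begin
        ∣ ⟨ P ⟩ ∣ + ∣ f P ∣       ≡⟨ cong (λ S → ∣ S ∣ + ∣ f P ∣) (sym (⟨⟩-stable 0∈P)) ⟩
        ∣ ⟨ P ⟩ ⊞ P ∣ + ∣ f P ∣   ≤⟨ ∣suc·ˢP∣+∣fP∣≤∣suc·ˢfP∣+2 order ⟩
        ∣ ⟨ f P ⟩ ⊞ f P ∣ + 2     ≡⟨ cong (λ S → ∣ S ∣ + 2) (⟨⟩-stable 0∈fP) ⟩
        ∣ ⟨ f P ⟩ ∣ + 2           ≤⟨ +-monoˡ-≤ 2 (∣⟨fX⟩∣≤∣⟨X⟩∣ 0∈P) ⟩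
        ∣ ⟨ P ⟩ ∣ + 2             ∎)
        where open ≤-Reasoning

lemma2p3 : (G : FiniteAbelianGroup) (f : Subset (FiniteAbelianGroup.order G) → Subset (FiniteAbelianGroup.order G)) →
    IsP₀Automorphism G f →
    ∀ X → InP₀ G X → ∣ X ∣ ≡ 2 → ∣ f X ∣ ≡ 2
lemma2p3 G f iso X 0∈X ∣X∣≡2 with x∈p∧∣p∣≡2⇒p≡⁅x⁆∪⁅y⁆ 0∈X ∣X∣≡2
... | a , refl = ≤-antisym (∣f⁅0⁆∪⁅a⁆∣≤2 G iso a) (2≤∣fX∣ G iso 0∈X (∣p∣≡2⇒p≢⁅x⁆ ∣X∣≡2))
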